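{- Let $\phi$ be a 3CNF formula with variables $x_1,\dots,x_n$ and clauses $C_1,\dots,C_m$ (each clause a disjunction of three literals), and let $G_\phi$ be the weighted graph constructed below. Then $\phi$ is satisfiable if and only if the minimum, over all partitions $\mathcal{P}$ of $V(G_\phi)$ in which the vertices $\mathrm{True}$ and $\mathrm{False}$ lie in different parts, of $\max_{u\in V(G_\phi)}\mathrm{cut}_u(\mathcal{P})$ equals $1$.
   Context: Construction of $G_\phi$ (with $2+4n+5m$ vertices and $6n+8m$ edges): there are two vertices $\mathrm{True}$ and $\mathrm{False}$. For each variable $x_i$ there are four vertices $x_i^T, x_i^F, x_i^\dagger, \bar{x}_i^\dagger$, with edges $(\mathrm{True},x_i^T)$ and $(\mathrm{False},x_i^F)$ of infinite weight, and unit-weight edges $(x_i^T,x_i^\dagger)$, $(x_i^T,\bar{x}_i^\dagger)$, $(x_i^F,x_i^\dagger)$, $(x_i^F,\bar{x}_i^\dagger)$. For a literal $y$, let $y^\dagger=x_i^\dagger$ if $y=x_i$ and $y^\dagger=\bar{x}_i^\dagger$ if $y=\neg x_i$. For each clause $C=(y_1\lor y_2\lor y_3)$ there are five new vertices $p_{C,1},p_{C,2},p_{C,3},C_a,C_b$, with unit-weight edges $(p_{C,2},C_b)$, $(p_{C,3},C_b)$, $(p_{C,1},C_a)$, $(C_b,C_a)$, and $(p_{C,j},y_j^\dagger)$ for $j=1,2,3$, plus an infinite-weight edge $(C_a,\mathrm{True})$. For a partition $\mathcal{P}$ and vertex $u$, $\mathrm{cut}_u(\mathcal{P})$ is the total weight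 of edges incident to $u$ whose endpoints lie in different parts of $\mathcal{P}$. -}

module Defs where

open import Data.Nat as ℕ using (ℕ; zero; suc; _≡ᵇ_)
open import Data.Fin as Fin using (Fin)
open import Data.Bool using (Bool; true; false; _∧_; _∨_; not; if_then_else_)
open import Data.Product using (_×_; _,_; Σ; ∃)
open import Data.List using (List; []; _∷_; _++_; map; concatMap; foldr; allFin)
open import Relation.Nullary.Decidable using (⌊_⌋)
open import Relation.Binary.PropositionalEquality using (_≡_)

-- A literal over variables x_0 … x_{n-1}: (i , true) is x_i, (i , false) is ¬x_i.
Literal : ℕ → Set
Literal n = Fin n × Bool

Clause : ℕ → Set
Clause n = Fin 3 → Literal n

Formula : ℕ → ℕ → Set
Formula n m = Fin m → Clause n

Assignment : ℕ → Set
Assignment n = Fin n → Bool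

litValue : ∀ {n} → Assignment n → Literal n → Bool
litValue σ (i , true)  = σ i
litValue σ (i , false) = not (σ i)

Satisfies : ∀ {n m} → Assignment n → Formula n m → Set
Satisfies σ φ = ∀ c → ∃ λ j → litValue σ (φ c j) ≡ true

Satisfiable : ∀ {n m} → Formula n m → Set
Satisfiable {n} φ = Σ (Assignment n) λ σ → Satisfies σ φ

data Wt : Set where
  fin : ℕ → Wt
  ∞   : Wt

_+ʷ_ : Wt → Wt → Wt
fin a +ʷ fin b = fin (a ℕ.+ b)
_     +ʷ _     = ∞

_⊔ʷ_ : Wt → Wt → Wt
fin a ⊔ʷ fin b = fin (a ℕ.⊔ b)
_     ⊔ʷ _     = ∞

data _≤ʷ_ : Wt → Wt → Set where
  fin≤fin : ∀ {a b} → a ℕ.≤ b → fin a ≤ʷ fin b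
  ≤∞      : ∀ {w} → w ≤ʷ ∞

data Vertex (n m : ℕ) : Set where
  True False : Vertex n m
  xT xF x† x̄† : Fin n → Vertex n m
  p  : Fin m → Fin 3 → Vertex n m
  Ca Cb : Fin m → Vertex n m

infix 4 _==_
_==_ : ∀ {n m} → Vertex n m → Vertex n m → Bool
True   == True   = true
False  == False  = true
xT i   == xT j   = ⌊ i Fin.≟ j ⌋
xF i   == xF j   = ⌊ i Fin.≟ j ⌋
x† i   == x† j   = ⌊ i Fin.≟ j ⌋
x̄† i   == x̄† j   = ⌊ i Fin.≟ j ⌋
p c j  == p d k  = ⌊ c Fin.≟ d ⌋ ∧ ⌊ j Fin.≟ k ⌋
Ca c   == Ca d   = ⌊ c Fin.≟ d ⌋
Cb c   == Cb d   = ⌊ c Fin.≟ d ⌋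
_      == _      = false

allVertices : (n m : ℕ) → List (Vertex n m)
allVertices n m =
  True ∷ False ∷
  (map xT (allFin n) ++ map xF (allFin n) ++ map x† (allFin n) ++ map x̄† (allFin n)
   ++ concatMap (λ c → map (p c) (allFin 3)) (allFin m)
   ++ map Ca (allFin m) ++ map Cb (allFin m))

lit† : ∀ {n m} → Literal n → Vertex n m
lit† (i , true)  = x† i
lit† (i , false) = x̄† i

Edge : ℕ → ℕ → Set
Edge n m = Vertex n m × Vertex n m × Wt

varEdges : ∀ {n m} → Fin n → List (Edge n m)
varEdges i =
  (True , xT i , ∞) ∷ (False , xF i , ∞) ∷
  (xT i , x† i , fin 1) ∷ (xT i , x̄† i , fin 1) ∷
  (xF i , x† i , fin 1) ∷ (xF i , x̄† i , fin 1) ∷ []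

-- Fin 3 indices 0,1,2 correspond to the paper's j = 1,2,3.
j₁ j₂ j₃ : Fin 3
j₁ = Fin.zero
j₂ = Fin.suc Fin.zero
j₃ = Fin.suc (Fin.suc Fin.zero)

clauseEdges : ∀ {n m} → Formula n m → Fin m → List (Edge n m)
clauseEdges φ c =
  (p c j₂ , Cb c , fin 1) ∷ (p c j₃ , Cb c , fin 1) ∷
  (p c j₁ , Ca c , fin 1) ∷ (Cb c , Ca c , fin 1) ∷
  (p c j₁ , lit† (φ c j₁) , fin 1) ∷
  (p c j₂ , lit† (φ c j₂) , fin 1) ∷
  (p c j₃ , lit† (φ c j₃) , fin 1) ∷
  (Ca c , True , ∞) ∷ []

edges : ∀ {n m} → Formula n m → List (Edge n m)
edges {n} {m} φ = concatMap varEdges (allFin n) ++ concatMap (clauseEdges φ) (allFin m)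

-- A partition of V(G_φ) is given by labelling vertices with part indices;
-- two vertices are in the same part iff they have the same label.
Partition : ℕ → ℕ → Set
Partition n m = Vertex n m → ℕ

sameBlock : ∀ {n m} → Partition n m → Vertex n m → Vertex n m → Bool
sameBlock P a b = P a ≡ᵇ P b

cut : ∀ {n m} → Formula n m → Partition n m → Vertex n m → Wt
cut φ P u = foldr step (fin 0) (edges φ)
  where
  step : _ → Wt → Wt
  step (a , b , w) acc =
    (if ((u == a) ∨ (u == b)) ∧ not (sameBlock P a b) then w else fin 0) +ʷ acc

maxCut : ∀ {n m} → Formula n m → Partition n m → Wt
maxCut {n} {m} φ P = foldr (λ u acc → cut φ P u ⊔ʷ acc) (fin 0) (allVertices n m)

Separating : ∀ {n m} → Partition n m → Set
Separating P = sameBlock P True False ≡ false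

MinMaxCutIs : ∀ {n m} → Formula n m → Wt → Set
MinMaxCutIs {n} {m} φ k =
  (Σ (Partition n m) λ P → Separating P × maxCut φ P ≡ k) ×
  (∀ (P : Partition n m) → Separating P → k ≤ʷ maxCut φ P)

module Submission where

-- In a separating partition either some ∞-edge is cut, or True, every x_i^T and every C_a lie on one
-- side and False and every x_i^F on the other.  Then each literal vertex y^† is adjacent to both x_i^T
-- and x_i^F, so its cut is at least 1; this is the lower bound.  If moreover every cut is at most 1,
-- all other edges at y^†, in particular (p_{C,j}, y_j^†), are uncut, and at C_a and C_b at most one unit
-- edge is cut, so some p_{C,j} lies with C_a, that is with True, and then so does y_j^†.  Hence y_j is
-- true under the assignment "x_i holds iff x_i^† lies with True" (for y_j = ¬x_i, because x_i^F lies
-- with x_i^† or with x̄_i^†).  Conversely, a satisfying assignment puts every vertex on the side of the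
-- truth value it carries (C_a carries true, C_b carries y_2 ∨ y_3): no ∞-edge and no edge
-- (p_{C,j}, y_j^†) is cut, and every vertex meets at most one cut edge, which has weight 1.

open import Defs
open import Algebra.Bundles using (CommutativeMonoid)
open import Data.Bool using (Bool; true; false; _∧_; _∨_; not; if_then_else_)
open import Data.Bool.Properties using (∨-zeroʳ; ∧-zeroʳ; T-≡)
open import Data.Fin as Fin using (Fin)
open import Data.Fin.Properties using (punchInᵢ≢i)
open import Data.List using (List; []; _∷_; _++_; map; concatMap; foldr; allFin; tabulate)
open import Data.List.Membership.Propositional using (_∈_)
open import Data.List.Membership.Propositional.Properties using (∈-++⁺ˡ; ∈-++⁺ʳ; ∈-map⁺; ∈-allFin; ∈-concat⁺′)
open import Data.List.Relation.Binary.Sublist.Propositional using (_⊆_; []; _∷_; _∷ʳ_; ⊆-refl; ⊆-trans; from∈; minimum)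
open import Data.List.Relation.Binary.Sublist.Propositional.Properties using (++⁺ˡ; ++⁺ʳ; ++⁺)
open import Data.List.Relation.Unary.All using (All; []; _∷_)
open import Data.List.Relation.Unary.Any using (here; there)
open import Data.Nat as ℕ using (ℕ; _≥_; _≟_; z≤n; s≤s)
import Data.Nat.Properties as ℕ
open import Data.Product using (_×_; _,_; proj₁; proj₂; ∃)
open import Data.Sum using (_⊎_; inj₁; inj₂)
open import Data.Vec.Functional using (Vector; removeAt)
open import Function.Base using (_∘_; id)
open import Function.Bundles using (_⇔_; mk⇔; Equivalence)
open import Relation.Binary.PropositionalEquality
open import Relation.Nullary using (yes; no; contradiction)
open import Relation.Nullary.Decidable using (⌊_⌋; isYes≗does; dec-true; dec-false)

+ʷ-identityˡ : ∀ x → fin 0 +ʷ x ≡ x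
+ʷ-identityˡ (fin a) = refl
+ʷ-identityˡ ∞       = refl

+ʷ-identityʳ : ∀ x → x +ʷ fin 0 ≡ x
+ʷ-identityʳ (fin a) = cong fin (ℕ.+-identityʳ a)
+ʷ-identityʳ ∞       = refl

+ʷ-assoc : ∀ x y z → (x +ʷ y) +ʷ z ≡ x +ʷ (y +ʷ z)
+ʷ-assoc (fin a) (fin b) (fin c) = cong fin (ℕ.+-assoc a b c)
+ʷ-assoc (fin a) (fin b) ∞       = refl
+ʷ-assoc (fin a) ∞       z       = refl
+ʷ-assoc ∞       y       z       = refl

+ʷ-comm : ∀ x y → x +ʷ y ≡ y +ʷ x
+ʷ-comm (fin a) (fin b) = cong fin (ℕ.+-comm a b)
+ʷ-comm (fin a) ∞       = refl
+ʷ-comm ∞       (fin b) = refl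
+ʷ-comm ∞       ∞       = refl

+ʷ-commutativeMonoid : CommutativeMonoid _ _
+ʷ-commutativeMonoid = record
  { Carrier = Wt
  ; _≈_ = _≡_
  ; _∙_ = _+ʷ_
  ; ε = fin 0
  ; isCommutativeMonoid = record
    { isMonoid = record
      { isSemigroup = record
        { isMagma = record { isEquivalence = isEquivalence ; ∙-cong = cong₂ _+ʷ_ }
        ; assoc = +ʷ-assoc
        }
      ; identity = +ʷ-identityˡ , +ʷ-identityʳ
      }
    ; comm = +ʷ-comm
    }
  }

open import Algebra.Properties.CommutativeMonoid.Sum +ʷ-commutativeMonoid
  using (sum; sum-remove; sum-cong-≗; sum-replicate-zero)

sum-zero : ∀ {k} (t : Vector Wt k) → (∀ i → t i ≡ fin 0) → sum t ≡ fin 0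
sum-zero {k} t t≡0 = trans (sum-cong-≗ t≡0) (sum-replicate-zero k)

sum-concentrated : ∀ {k} (t : Vector Wt k) i → (∀ j → j ≢ i → t j ≡ fin 0) → sum t ≡ t i
sum-concentrated {ℕ.suc k} t i t≡0 = begin
  sum t                       ≡⟨ sum-remove t ⟩
  t i +ʷ sum (removeAt t i)   ≡⟨ cong (t i +ʷ_) (sum-zero _ λ j → t≡0 _ (punchInᵢ≢i i j)) ⟩
  t i +ʷ fin 0                ≡⟨ +ʷ-identityʳ (t i) ⟩
  t i                         ∎
  where open ≡-Reasoning

≤ʷ-refl : ∀ {x} → x ≤ʷ x
≤ʷ-refl {fin a} = fin≤fin ℕ.≤-refl
≤ʷ-refl {∞}     = ≤∞

≤ʷ-reflexive : ∀ {x y} → x ≡ y → x ≤ʷ y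
≤ʷ-reflexive refl = ≤ʷ-refl

≤ʷ-trans : ∀ {x y z} → x ≤ʷ y → y ≤ʷ z → x ≤ʷ z
≤ʷ-trans (fin≤fin a≤b) (fin≤fin b≤c) = fin≤fin (ℕ.≤-trans a≤b b≤c)
≤ʷ-trans _             ≤∞            = ≤∞

≤ʷ-antisym : ∀ {x y} → x ≤ʷ y → y ≤ʷ x → x ≡ y
≤ʷ-antisym (fin≤fin a≤b) (fin≤fin b≤a) = cong fin (ℕ.≤-antisym a≤b b≤a)
≤ʷ-antisym ≤∞            ≤∞            = refl

fin0≤ʷ : ∀ x → fin 0 ≤ʷ x
fin0≤ʷ (fin a) = fin≤fin z≤n
fin0≤ʷ ∞       = ≤∞

+ʷ-mono-≤ʷ : ∀ {x y z w} → x ≤ʷ y → z ≤ʷ w → (x +ʷ z) ≤ʷ (y +ʷ w)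
+ʷ-mono-≤ʷ (fin≤fin a≤b) (fin≤fin c≤d) = fin≤fin (ℕ.+-mono-≤ a≤b c≤d)
+ʷ-mono-≤ʷ (fin≤fin _)   ≤∞            = ≤∞
+ʷ-mono-≤ʷ ≤∞            _             = ≤∞

x≤ʷy+ʷx : ∀ x y → x ≤ʷ (y +ʷ x)
x≤ʷy+ʷx x y = subst (_≤ʷ (y +ʷ x)) (+ʷ-identityˡ x) (+ʷ-mono-≤ʷ (fin0≤ʷ y) ≤ʷ-refl)

⊔ʷ-upperˡ : ∀ x y → x ≤ʷ (x ⊔ʷ y)
⊔ʷ-upperˡ (fin a) (fin b) = fin≤fin (ℕ.m≤m⊔n a b)
⊔ʷ-upperˡ (fin a) ∞       = ≤∞
⊔ʷ-upperˡ ∞       y       = ≤∞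

⊔ʷ-upperʳ : ∀ x y → y ≤ʷ (x ⊔ʷ y)
⊔ʷ-upperʳ (fin a) (fin b) = fin≤fin (ℕ.m≤n⊔m a b)
⊔ʷ-upperʳ (fin a) ∞       = ≤∞
⊔ʷ-upperʳ ∞       y       = ≤∞

⊔ʷ-lub : ∀ {x y z} → x ≤ʷ z → y ≤ʷ z → (x ⊔ʷ y) ≤ʷ z
⊔ʷ-lub (fin≤fin a≤c) (fin≤fin b≤c) = fin≤fin (ℕ.⊔-lub a≤c b≤c)
⊔ʷ-lub _             ≤∞            = ≤∞

module _ {A : Set} (f : A → Wt) where

  foldr-⊔ʷ-upper : ∀ {x xs} → x ∈ xs → f x ≤ʷ foldr (λ y acc → f y ⊔ʷ acc) (fin 0) xs
  foldr-⊔ʷ-upper (here refl)  = ⊔ʷ-upperˡ _ _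
  foldr-⊔ʷ-upper (there x∈xs) = ≤ʷ-trans (foldr-⊔ʷ-upper x∈xs) (⊔ʷ-upperʳ _ _)

  foldr-⊔ʷ-lub : ∀ {k} xs → (∀ x → f x ≤ʷ k) → foldr (λ y acc → f y ⊔ʷ acc) (fin 0) xs ≤ʷ k
  foldr-⊔ʷ-lub []       f≤k = fin0≤ʷ _
  foldr-⊔ʷ-lub (x ∷ xs) f≤k = ⊔ʷ-lub (f≤k x) (foldr-⊔ʷ-lub xs f≤k)

⊆-concatMap : ∀ {A B : Set} (f : A → List B) {x xs} → x ∈ xs → f x ⊆ concatMap f xs
⊆-concatMap f {xs = y ∷ ys} (here refl)  = ++⁺ʳ _ ⊆-refl
⊆-concatMap f {xs = y ∷ ys} (there x∈ys) = ++⁺ˡ (f y) (⊆-concatMap f x∈ys)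

⌊≟⌋-diag : ∀ {k} (i : Fin k) → ⌊ i Fin.≟ i ⌋ ≡ true
⌊≟⌋-diag i = trans (isYes≗does (i Fin.≟ i)) (dec-true (i Fin.≟ i) refl)

⌊≟⌋-apart : ∀ {k} {i j : Fin k} → i ≢ j → ⌊ i Fin.≟ j ⌋ ≡ false
⌊≟⌋-apart {i = i} {j} i≢j = trans (isYes≗does (i Fin.≟ j)) (dec-false (i Fin.≟ j) i≢j)

p==p-apartˡ : ∀ {n m} {c d : Fin m} {j k} → c ≢ d → (p {n} c j == p d k) ≡ false
p==p-apartˡ c≢d = cong (_∧ _) (⌊≟⌋-apart c≢d)

p==p-apartʳ : ∀ {n m} (c : Fin m) j k → j ≢ k → (p {n} c j == p c k) ≡ false
p==p-apartʳ c j k j≢k = trans (cong (⌊ c Fin.≟ c ⌋ ∧_) (⌊≟⌋-apart j≢k)) (∧-zeroʳ _)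

module _ {n m : ℕ} where

  ==-refl : (u : Vertex n m) → (u == u) ≡ true
  ==-refl True    = refl
  ==-refl False   = refl
  ==-refl (xT i)  = ⌊≟⌋-diag i
  ==-refl (xF i)  = ⌊≟⌋-diag i
  ==-refl (x† i)  = ⌊≟⌋-diag i
  ==-refl (x̄† i)  = ⌊≟⌋-diag i
  ==-refl (p c j) = cong₂ _∧_ (⌊≟⌋-diag c) (⌊≟⌋-diag j)
  ==-refl (Ca c)  = ⌊≟⌋-diag c
  ==-refl (Cb c)  = ⌊≟⌋-diag c

  sameBlock⇒≡ : ∀ (P : Partition n m) {a b} → sameBlock P a b ≡ true → P a ≡ P b
  sameBlock⇒≡ P {a} {b} eq = ℕ.≡ᵇ⇒≡ (P a) (P b) (Equivalence.from T-≡ eq)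

  ≡⇒sameBlock : ∀ (P : Partition n m) {a b} → P a ≡ P b → sameBlock P a b ≡ true
  ≡⇒sameBlock P {a} {b} eq = Equivalence.to T-≡ (ℕ.≡⇒≡ᵇ (P a) (P b) eq)

  ≢⇒sameBlock : ∀ (P : Partition n m) {a b} → P a ≢ P b → sameBlock P a b ≡ false
  ≢⇒sameBlock P {a} {b} apart with sameBlock P a b in eq
  ... | true  = contradiction (sameBlock⇒≡ P eq) apart
  ... | false = refl

  separating⇒apart : ∀ (P : Partition n m) → Separating P → P True ≢ P False
  separating⇒apart P sep eq with () ← trans (sym (≡⇒sameBlock P eq)) sep

  private
    xTs xFs x†s x̄†s : List (Vertex n m)
    xTs = map xT (allFin n)
    xFs = map xF (allFin n)
    x†s = map x† (allFin n)
    x̄†s = map x̄† (allFin n)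

    ps : Fin m → List (Vertex n m)
    ps c = map (p c) (allFin 3)

  allVertices-complete : ∀ u → u ∈ allVertices n m
  allVertices-complete True    = here refl
  allVertices-complete False   = there (here refl)
  allVertices-complete (xT i)  = there (there (∈-++⁺ˡ (∈-map⁺ xT (∈-allFin i))))
  allVertices-complete (xF i)  = there (there (∈-++⁺ʳ xTs (∈-++⁺ˡ (∈-map⁺ xF (∈-allFin i)))))
  allVertices-complete (x† i)  = there (there (∈-++⁺ʳ xTs (∈-++⁺ʳ xFs (∈-++⁺ˡ (∈-map⁺ x† (∈-allFin i))))))
  allVertices-complete (x̄† i)  =
    there (there (∈-++⁺ʳ xTs (∈-++⁺ʳ xFs (∈-++⁺ʳ x†s (∈-++⁺ˡ (∈-map⁺ x̄† (∈-allFin i)))))))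
  allVertices-complete (p c j) = there (there (∈-++⁺ʳ xTs (∈-++⁺ʳ xFs (∈-++⁺ʳ x†s (∈-++⁺ʳ x̄†s (∈-++⁺ˡ
    (∈-concat⁺′ (∈-map⁺ (p c) (∈-allFin j)) (∈-map⁺ ps (∈-allFin c)))))))))
  allVertices-complete (Ca c)  = there (there (∈-++⁺ʳ xTs (∈-++⁺ʳ xFs (∈-++⁺ʳ x†s (∈-++⁺ʳ x̄†s
    (∈-++⁺ʳ (concatMap ps (allFin m)) (∈-++⁺ˡ (∈-map⁺ Ca (∈-allFin c)))))))))
  allVertices-complete (Cb c)  = there (there (∈-++⁺ʳ xTs (∈-++⁺ʳ xFs (∈-++⁺ʳ x†s (∈-++⁺ʳ x̄†s
    (∈-++⁺ʳ (concatMap ps (allFin m)) (∈-++⁺ʳ (map Ca (allFin m)) (∈-map⁺ Cb (∈-allFin c)))))))))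

  crossingWeight : Partition n m → Edge n m → Wt
  crossingWeight P (a , b , w) = if not (sameBlock P a b) then w else fin 0

  crossingTotal : Partition n m → List (Edge n m) → Wt
  crossingTotal P = foldr (λ e total → crossingWeight P e +ʷ total) (fin 0)

  crossingWeight-apart : ∀ P {a b w} → P a ≢ P b → crossingWeight P (a , b , w) ≡ w
  crossingWeight-apart P {w = w} apart = cong (λ s → if not s then w else fin 0) (≢⇒sameBlock P apart)

  data _∈ₑ_ (u : Vertex n m) : Edge n m → Set where
    source : ∀ {b w} → u ∈ₑ (u , b , w)
    target : ∀ {a w} → u ∈ₑ (a , u , w)

  -- Opaque, so that the list xs can be read off cutOf P u xs: this is what lets the chains built
  -- with _∷⁰_ and _∷¹_ evaluate a cut one edge at a time.
  opaque
    contribution : Partition n m → Vertex n m → Edge n m → Wt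
    contribution P u (a , b , w) = if ((u == a) ∨ (u == b)) ∧ not (sameBlock P a b) then w else fin 0

    contribution-∈ₑ : ∀ P {u e} → u ∈ₑ e → contribution P u e ≡ crossingWeight P e
    contribution-∈ₑ P {u} (source {b} {w}) =
      cong (λ x → if (x ∨ (u == b)) ∧ not (sameBlock P u b) then w else fin 0) (==-refl u)
    contribution-∈ₑ P {u} (target {a} {w}) =
      cong (λ x → if x ∧ not (sameBlock P a u) then w else fin 0)
           (trans (cong ((u == a) ∨_) (==-refl u)) (∨-zeroʳ (u == a)))

    contribution-uncut : ∀ P u {a b w} → sameBlock P a b ≡ true → contribution P u (a , b , w) ≡ fin 0
    contribution-uncut P u {a} {b} {w} eq =
      cong (λ x → if x then w else fin 0)
           (trans (cong (λ s → ((u == a) ∨ (u == b)) ∧ not s) eq) (∧-zeroʳ ((u == a) ∨ (u == b))))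

    contribution-away : ∀ P u {a b w} → (u == a) ≡ false → (u == b) ≡ false → contribution P u (a , b , w) ≡ fin 0
    contribution-away P u u≠a u≠b rewrite u≠a | u≠b = refl

    cutOf : Partition n m → Vertex n m → List (Edge n m) → Wt
    cutOf P u = foldr (λ e total → contribution P u e +ʷ total) (fin 0)

    cut≡cutOf : ∀ φ P u → cut φ P u ≡ cutOf P u (edges φ)
    cut≡cutOf φ P u = refl

    cutOf-[] : ∀ {P u} → cutOf P u [] ≡ fin 0
    cutOf-[] = refl

    infixr 5 _∷⁰_ _∷¹_

    _∷⁰_ : ∀ {P u e es s} → contribution P u e ≡ fin 0 → cutOf P u es ≡ s → cutOf P u (e ∷ es) ≡ s
    e↦0 ∷⁰ rest = trans (cong₂ _+ʷ_ e↦0 rest) (+ʷ-identityˡ _)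

    _∷¹_ : ∀ {P u e es s} → u ∈ₑ e → cutOf P u es ≡ s → cutOf P u (e ∷ es) ≡ crossingWeight P e +ʷ s
    _∷¹_ {P} u∈e rest = cong₂ _+ʷ_ (contribution-∈ₑ P u∈e) rest

    cutOf-++ : ∀ P u xs ys → cutOf P u (xs ++ ys) ≡ cutOf P u xs +ʷ cutOf P u ys
    cutOf-++ P u []       ys = sym (+ʷ-identityˡ _)
    cutOf-++ P u (x ∷ xs) ys =
      trans (cong (contribution P u x +ʷ_) (cutOf-++ P u xs ys)) (sym (+ʷ-assoc _ _ _))

    cutOf-concatMap : ∀ P u {A : Set} (f : A → List (Edge n m)) {k} (g : Fin k → A) →
                      cutOf P u (concatMap f (tabulate g)) ≡ sum (λ i → cutOf P u (f (g i)))
    cutOf-concatMap P u f {ℕ.zero}  g = refl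
    cutOf-concatMap P u f {ℕ.suc k} g =
      trans (cutOf-++ P u (f (g Fin.zero)) _)
            (cong (cutOf P u (f (g Fin.zero)) +ʷ_) (cutOf-concatMap P u f (g ∘ Fin.suc)))

    cutOf-mono : ∀ P u {xs ys} → xs ⊆ ys → cutOf P u xs ≤ʷ cutOf P u ys
    cutOf-mono P u []             = ≤ʷ-refl
    cutOf-mono P u (y ∷ʳ xs⊆ys)   = ≤ʷ-trans (cutOf-mono P u xs⊆ys) (x≤ʷy+ʷx _ _)
    cutOf-mono P u (refl ∷ xs⊆ys) = +ʷ-mono-≤ʷ ≤ʷ-refl (cutOf-mono P u xs⊆ys)

    cutOf-incident : ∀ P {u xs} → All (u ∈ₑ_) xs → cutOf P u xs ≡ crossingTotal P xs
    cutOf-incident P []         = refl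
    cutOf-incident P (u∈e ∷ us) = cong₂ _+ʷ_ (contribution-∈ₑ P u∈e) (cutOf-incident P us)

  cut-split : ∀ φ P u →
              cut φ P u ≡ sum (λ i → cutOf P u (varEdges i)) +ʷ sum (λ c → cutOf P u (clauseEdges φ c))
  cut-split φ P u = begin
    cut φ P u                                                                      ≡⟨ cut≡cutOf φ P u ⟩
    cutOf P u (concatMap varEdges (allFin n) ++ concatMap (clauseEdges φ) (allFin m)) ≡⟨ cutOf-++ P u _ _ ⟩
    cutOf P u (concatMap varEdges (allFin n)) +ʷ cutOf P u (concatMap (clauseEdges φ) (allFin m))
      ≡⟨ cong₂ _+ʷ_ (cutOf-concatMap P u varEdges id) (cutOf-concatMap P u (clauseEdges φ) id) ⟩
    sum (λ i → cutOf P u (varEdges i)) +ʷ sum (λ c → cutOf P u (clauseEdges φ c))  ∎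
    where open ≡-Reasoning

  cut≤-by-gadgets : ∀ φ P u {x y k} →
                    sum (λ i → cutOf P u (varEdges i)) ≡ x → sum (λ c → cutOf P u (clauseEdges φ c)) ≡ y →
                    (x +ʷ y) ≤ʷ k → cut φ P u ≤ʷ k
  cut≤-by-gadgets φ P u vars clauses bound =
    ≤ʷ-trans (≤ʷ-reflexive (trans (cut-split φ P u) (cong₂ _+ʷ_ vars clauses))) bound

  crossingTotal≤cut : ∀ φ P {u xs} → xs ⊆ edges φ → All (u ∈ₑ_) xs → crossingTotal P xs ≤ʷ cut φ P u
  crossingTotal≤cut φ P {u} xs⊆ us =
    subst₂ _≤ʷ_ (cutOf-incident P us) (sym (cut≡cutOf φ P u)) (cutOf-mono P u xs⊆)

  cut≤maxCut : ∀ φ P u → cut φ P u ≤ʷ maxCut φ P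
  cut≤maxCut φ P u = foldr-⊔ʷ-upper (cut φ P) (allVertices-complete u)

  maxCut-lub : ∀ φ P {k} → (∀ u → cut φ P u ≤ʷ k) → maxCut φ P ≤ʷ k
  maxCut-lub φ P = foldr-⊔ʷ-lub (cut φ P) (allVertices n m)

  varEdges⊆ : ∀ i → varEdges {m = m} i ⊆ concatMap varEdges (allFin n)
  varEdges⊆ i = ⊆-concatMap varEdges (∈-allFin i)

  clauseEdges⊆ : ∀ (φ : Formula n m) c → clauseEdges φ c ⊆ concatMap (clauseEdges φ) (allFin m)
  clauseEdges⊆ φ c = ⊆-concatMap (clauseEdges φ) (∈-allFin c)

  ⊆-varEdges⇒⊆-edges : ∀ φ {xs} i → xs ⊆ varEdges i → xs ⊆ edges φ
  ⊆-varEdges⇒⊆-edges φ i xs⊆ = ++⁺ʳ (concatMap (clauseEdges φ) (allFin m)) (⊆-trans xs⊆ (varEdges⊆ i))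

  ⊆-clauseEdges⇒⊆-edges : ∀ φ {xs} c → xs ⊆ clauseEdges φ c → xs ⊆ edges φ
  ⊆-clauseEdges⇒⊆-edges φ c xs⊆ = ++⁺ˡ (concatMap varEdges (allFin n)) (⊆-trans xs⊆ (clauseEdges⊆ φ c))

  ⊆-both⇒⊆-edges : ∀ φ {xs ys} i c → xs ⊆ varEdges i → ys ⊆ clauseEdges φ c → (xs ++ ys) ⊆ edges φ
  ⊆-both⇒⊆-edges φ i c xs⊆ ys⊆ = ++⁺ (⊆-trans xs⊆ (varEdges⊆ i)) (⊆-trans ys⊆ (clauseEdges⊆ φ c))

  uncut-if-heavy : ∀ P {a b} → crossingTotal P ((a , b , ∞) ∷ []) ≤ʷ fin 1 → P a ≡ P b
  uncut-if-heavy P {a} {b} bound with P a ≟ P b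
  ... | yes together = together
  ... | no apart     =
    contradiction (subst (λ x → (x +ʷ fin 0) ≤ʷ fin 1) (crossingWeight-apart P apart) bound) λ ()

  at-most-one-crossing : ∀ P {a₁ b₁ a₂ b₂} →
                         crossingTotal P ((a₁ , b₁ , fin 1) ∷ (a₂ , b₂ , fin 1) ∷ []) ≤ʷ fin 1 →
                         P a₁ ≡ P b₁ ⊎ P a₂ ≡ P b₂
  at-most-one-crossing P {a₁} {b₁} {a₂} {b₂} bound with P a₁ ≟ P b₁ | P a₂ ≟ P b₂
  ... | yes together | _            = inj₁ together
  ... | no _         | yes together = inj₂ together
  ... | no apart₁    | no apart₂    =
    contradiction (subst (_≤ʷ fin 1)
                         (cong₂ (λ x y → x +ʷ (y +ʷ fin 0)) (crossingWeight-apart P apart₁) (crossingWeight-apart P apart₂))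
                         bound)
                  λ { (fin≤fin (s≤s ())) }

-- The lower bound

module _ {n m : ℕ} (φ : Formula n m) (P : Partition n m) where

  crossing≤maxCut : ∀ {u a b w} → ((a , b , w) ∷ []) ⊆ edges φ → u ∈ₑ (a , b , w) → P a ≢ P b → w ≤ʷ maxCut φ P
  crossing≤maxCut {u} {w = w} sel u∈e apart = ≤ʷ-trans
    (≤ʷ-reflexive (sym (trans (cong (_+ʷ fin 0) (crossingWeight-apart P apart)) (+ʷ-identityʳ w))))
    (≤ʷ-trans (crossingTotal≤cut φ P sel (u∈e ∷ [])) (cut≤maxCut φ P u))

  maxCut-≥1 : Separating P → Fin n → fin 1 ≤ʷ maxCut φ P
  maxCut-≥1 sep i with P True ≟ P (xT i) | P False ≟ P (xF i) | P (xT i) ≟ P (x† i)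
  ... | no apart | _ | _ =
    ≤ʷ-trans ≤∞ (crossing≤maxCut (⊆-varEdges⇒⊆-edges φ i (from∈ (here refl))) source apart)
  ... | yes _ | no apart | _ =
    ≤ʷ-trans ≤∞ (crossing≤maxCut (⊆-varEdges⇒⊆-edges φ i (from∈ (there (here refl)))) source apart)
  ... | yes _ | yes _ | no apart =
    crossing≤maxCut (⊆-varEdges⇒⊆-edges φ i (from∈ (there (there (here refl))))) target apart
  ... | yes True~xT | yes False~xF | yes xT~x† =
    crossing≤maxCut (⊆-varEdges⇒⊆-edges φ i (from∈ (there (there (there (there (here refl))))))) target
      λ xF~x† → separating⇒apart P sep (trans True~xT (trans xT~x† (trans (sym xF~x†) (sym False~xF))))

-- From a partition of maximum cut 1 to a satisfying assignment

lit†-varEdges : ∀ {n m} (l : Literal n) → let i = proj₁ l in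
  (xT i , lit† l , fin 1) ∈ varEdges {m = m} i × (xF i , lit† l , fin 1) ∈ varEdges {m = m} i
lit†-varEdges (i , true)  = there (there (here refl)) , there (there (there (there (here refl))))
lit†-varEdges (i , false) = there (there (there (here refl))) , there (there (there (there (there (here refl)))))

lit†-clauseEdge : ∀ {n m} (φ : Formula n m) c j → (p c j , lit† (φ c j) , fin 1) ∈ clauseEdges φ c
lit†-clauseEdge φ c Fin.zero                     = there (there (there (there (here refl))))
lit†-clauseEdge φ c (Fin.suc Fin.zero)           = there (there (there (there (there (here refl)))))
lit†-clauseEdge φ c (Fin.suc (Fin.suc Fin.zero)) = there (there (there (there (there (there (here refl))))))

module Backward {n m : ℕ} (φ : Formula n m) (P : Partition n m) (sep : Separating P)
                (bounded : ∀ u → cut φ P u ≤ʷ fin 1) where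

  heavy-edge-uncut : ∀ {a b} → ((a , b , ∞) ∷ []) ⊆ edges φ → P a ≡ P b
  heavy-edge-uncut {a} sel = uncut-if-heavy P (≤ʷ-trans (crossingTotal≤cut φ P sel (source ∷ [])) (bounded a))

  one-of-two-uncut : ∀ {u a₁ b₁ a₂ b₂} → ((a₁ , b₁ , fin 1) ∷ (a₂ , b₂ , fin 1) ∷ []) ⊆ edges φ →
                     u ∈ₑ (a₁ , b₁ , fin 1) → u ∈ₑ (a₂ , b₂ , fin 1) → P a₁ ≡ P b₁ ⊎ P a₂ ≡ P b₂
  one-of-two-uncut {u} sel u∈e₁ u∈e₂ =
    at-most-one-crossing P (≤ʷ-trans (crossingTotal≤cut φ P sel (u∈e₁ ∷ u∈e₂ ∷ [])) (bounded u))

  uncut-beside-split : ∀ {a b c y} → P a ≢ P b →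
                       ((a , y , fin 1) ∷ (c , y , fin 1) ∷ []) ⊆ edges φ →
                       ((b , y , fin 1) ∷ (c , y , fin 1) ∷ []) ⊆ edges φ → P c ≡ P y
  uncut-beside-split a≁b sel₁ sel₂ with one-of-two-uncut sel₁ target target | one-of-two-uncut sel₂ target target
  ... | inj₂ c~y | _        = c~y
  ... | inj₁ _   | inj₂ c~y = c~y
  ... | inj₁ a~y | inj₁ b~y = contradiction (trans a~y (sym b~y)) a≁b

  True~xT : ∀ i → P True ≡ P (xT i)
  True~xT i = heavy-edge-uncut (⊆-varEdges⇒⊆-edges φ i (from∈ (here refl)))

  False~xF : ∀ i → P False ≡ P (xF i)
  False~xF i = heavy-edge-uncut (⊆-varEdges⇒⊆-edges φ i (from∈ (there (here refl))))

  Ca~True : ∀ c → P (Ca c) ≡ P True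
  Ca~True c = heavy-edge-uncut
    (⊆-clauseEdges⇒⊆-edges φ c (from∈ (there (there (there (there (there (there (there (here refl))))))))))

  xT≁xF : ∀ i → P (xT i) ≢ P (xF i)
  xT≁xF i xT~xF = separating⇒apart P sep (trans (True~xT i) (trans xT~xF (sym (False~xF i))))

  xF~x†⊎xF~x̄† : ∀ i → P (xF i) ≡ P (x† i) ⊎ P (xF i) ≡ P (x̄† i)
  xF~x†⊎xF~x̄† i =
    one-of-two-uncut (⊆-varEdges⇒⊆-edges φ i (_ ∷ʳ _ ∷ʳ _ ∷ʳ _ ∷ʳ refl ∷ refl ∷ [])) source source

  p₁~Ca⊎Cb~Ca : ∀ c → P (p c j₁) ≡ P (Ca c) ⊎ P (Cb c) ≡ P (Ca c)
  p₁~Ca⊎Cb~Ca c = one-of-two-uncut (⊆-clauseEdges⇒⊆-edges φ c (_ ∷ʳ _ ∷ʳ refl ∷ refl ∷ minimum _)) target target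

  p₂~Cb⊎p₃~Cb : ∀ c → P (p c j₂) ≡ P (Cb c) ⊎ P (p c j₃) ≡ P (Cb c)
  p₂~Cb⊎p₃~Cb c = one-of-two-uncut (⊆-clauseEdges⇒⊆-edges φ c (refl ∷ refl ∷ minimum _)) target target

  p~lit† : ∀ c j → P (p c j) ≡ P (lit† (φ c j))
  p~lit† c j = uncut-beside-split (xT≁xF i)
    (⊆-both⇒⊆-edges φ i c (from∈ xT-edge) (from∈ (lit†-clauseEdge φ c j)))
    (⊆-both⇒⊆-edges φ i c (from∈ xF-edge) (from∈ (lit†-clauseEdge φ c j)))
    where
    i = proj₁ (φ c j)
    xT-edge = proj₁ (lit†-varEdges {m = m} (φ c j))
    xF-edge = proj₂ (lit†-varEdges {m = m} (φ c j))

  some-p~True : ∀ c → ∃ λ j → P (p c j) ≡ P True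
  some-p~True c with p₁~Ca⊎Cb~Ca c | p₂~Cb⊎p₃~Cb c
  ... | inj₁ p₁~Ca | _          = j₁ , trans p₁~Ca (Ca~True c)
  ... | inj₂ Cb~Ca | inj₁ p₂~Cb = j₂ , trans p₂~Cb (trans Cb~Ca (Ca~True c))
  ... | inj₂ Cb~Ca | inj₂ p₃~Cb = j₃ , trans p₃~Cb (trans Cb~Ca (Ca~True c))

  assignment : Assignment n
  assignment i = sameBlock P (x† i) True

  lit†~True⇒true : ∀ l → P (lit† l) ≡ P True → litValue assignment l ≡ true
  lit†~True⇒true (i , true)  x†~True = ≡⇒sameBlock P x†~True
  lit†~True⇒true (i , false) x̄†~True with xF~x†⊎xF~x̄† i
  ... | inj₁ xF~x† = cong not (≢⇒sameBlock P λ x†~True →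
                       separating⇒apart P sep (sym (trans (False~xF i) (trans xF~x† x†~True))))
  ... | inj₂ xF~x̄† = contradiction (sym (trans (False~xF i) (trans xF~x̄† x̄†~True))) (separating⇒apart P sep)

  satisfies : Satisfies assignment φ
  satisfies c with some-p~True c
  ... | j , pj~True = j , lit†~True⇒true (φ c j) (trans (sym (p~lit† c j)) pj~True)

-- From a satisfying assignment to a partition of maximum cut 1

block : Bool → ℕ
block false = 0
block true  = 1

-- The crossing weight, in Forward.partition below, of a unit edge whose ends carry truth values x and y.
mismatch : Bool → Bool → Wt
mismatch x y = if not (block x ℕ.≡ᵇ block y) then fin 1 else fin 0

mismatch≤1 : ∀ x y → (mismatch x y +ʷ fin 0) ≤ʷ fin 1
mismatch≤1 false false = fin≤fin z≤n
mismatch≤1 false true  = fin≤fin (s≤s z≤n)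
mismatch≤1 true  false = fin≤fin (s≤s z≤n)
mismatch≤1 true  true  = fin≤fin z≤n

mismatch-complementʳ : ∀ x y → (mismatch x y +ʷ (mismatch x (not y) +ʷ fin 0)) ≤ʷ fin 1
mismatch-complementʳ false false = fin≤fin (s≤s z≤n)
mismatch-complementʳ false true  = fin≤fin (s≤s z≤n)
mismatch-complementʳ true  false = fin≤fin (s≤s z≤n)
mismatch-complementʳ true  true  = fin≤fin (s≤s z≤n)

mismatch-complementˡ : ∀ x y → (mismatch x y +ʷ (mismatch (not x) y +ʷ fin 0)) ≤ʷ fin 1
mismatch-complementˡ false false = fin≤fin (s≤s z≤n)
mismatch-complementˡ false true  = fin≤fin (s≤s z≤n)
mismatch-complementˡ true  false = fin≤fin (s≤s z≤n)
mismatch-complementˡ true  true  = fin≤fin (s≤s z≤n)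

mismatch-or-output : ∀ x y → x ∨ y ≡ true → (mismatch x true +ʷ (mismatch y true +ʷ fin 0)) ≤ʷ fin 1
mismatch-or-output false true  _ = fin≤fin (s≤s z≤n)
mismatch-or-output true  false _ = fin≤fin (s≤s z≤n)
mismatch-or-output true  true  _ = fin≤fin z≤n

mismatch-or-gate : ∀ x y →
                   (mismatch x (x ∨ y) +ʷ (mismatch y (x ∨ y) +ʷ (mismatch (x ∨ y) true +ʷ fin 0))) ≤ʷ fin 1
mismatch-or-gate false false = fin≤fin (s≤s z≤n)
mismatch-or-gate false true  = fin≤fin (s≤s z≤n)
mismatch-or-gate true  false = fin≤fin (s≤s z≤n)
mismatch-or-gate true  true  = fin≤fin z≤n

some-true⇒∨₃ : ∀ (v : Fin 3 → Bool) j → v j ≡ true → v j₁ ∨ v j₂ ∨ v j₃ ≡ true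
some-true⇒∨₃ v Fin.zero                     vj = cong (_∨ (v j₂ ∨ v j₃)) vj
some-true⇒∨₃ v (Fin.suc Fin.zero)           vj = trans (cong (λ x → v j₁ ∨ x ∨ v j₃) vj) (∨-zeroʳ (v j₁))
some-true⇒∨₃ v (Fin.suc (Fin.suc Fin.zero)) vj =
  trans (cong (λ x → v j₁ ∨ v j₂ ∨ x) vj) (trans (cong (v j₁ ∨_) (∨-zeroʳ (v j₂))) (∨-zeroʳ (v j₁)))

data Gadget (n m : ℕ) : Set where
  noGadget     : Gadget n m
  varGadget    : Fin n → Gadget n m
  clauseGadget : Fin m → Gadget n m

gadget : ∀ {n m} → Vertex n m → Gadget n m
gadget True    = noGadget
gadget False   = noGadget
gadget (xT i)  = varGadget i
gadget (xF i)  = varGadget i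
gadget (x† i)  = varGadget i
gadget (x̄† i)  = varGadget i
gadget (p c j) = clauseGadget c
gadget (Ca c)  = clauseGadget c
gadget (Cb c)  = clauseGadget c

module _ {n m : ℕ} where

  varGadget-apart : ∀ {i k} → varGadget {n} {m} i ≢ varGadget k → ⌊ i Fin.≟ k ⌋ ≡ false
  varGadget-apart other = ⌊≟⌋-apart (other ∘ cong varGadget)

  clauseGadget-apart : ∀ {c d} → clauseGadget {n} {m} c ≢ clauseGadget d → ⌊ c Fin.≟ d ⌋ ≡ false
  clauseGadget-apart other = ⌊≟⌋-apart (other ∘ cong clauseGadget)

  gadget-elsewhere : ∀ {u : Vertex n m} {g g'} → gadget u ≡ g → g ≢ g' → gadget u ≢ g'
  gadget-elsewhere home g≢g' = g≢g' ∘ trans (sym home)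

module Forward {n m : ℕ} (φ : Formula n m) (σ : Assignment n) where

  value : Fin m → Fin 3 → Bool
  value c j = litValue σ (φ c j)

  truth : Vertex n m → Bool
  truth True    = true
  truth False   = false
  truth (xT i)  = true
  truth (xF i)  = false
  truth (x† i)  = σ i
  truth (x̄† i)  = not (σ i)
  truth (p c j) = value c j
  truth (Ca c)  = true
  truth (Cb c)  = value c j₂ ∨ value c j₃

  partition : Partition n m
  partition = block ∘ truth

  truth-lit† : ∀ l → truth (lit† l) ≡ litValue σ l
  truth-lit† (i , true)  = refl
  truth-lit† (i , false) = refl

  uncut : ∀ {u a b w} → truth a ≡ truth b → contribution partition u (a , b , w) ≡ fin 0
  uncut {u} {a} {b} eq = contribution-uncut partition u (≡⇒sameBlock partition {a} {b} (cong block eq))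

  away : ∀ {u a b w} → (u == a) ≡ false → (u == b) ≡ false → contribution partition u (a , b , w) ≡ fin 0
  away {u} = contribution-away partition u

  literal-edges-silent : ∀ {u es s} c → cutOf partition u es ≡ s →
    cutOf partition u ((p c j₁ , lit† (φ c j₁) , fin 1) ∷ (p c j₂ , lit† (φ c j₂) , fin 1) ∷
                       (p c j₃ , lit† (φ c j₃) , fin 1) ∷ es) ≡ s
  literal-edges-silent c rest = uncut (p~lit† j₁) ∷⁰ uncut (p~lit† j₂) ∷⁰ uncut (p~lit† j₃) ∷⁰ rest
    where
    p~lit† : ∀ j → value c j ≡ truth (lit† (φ c j))
    p~lit† j = sym (truth-lit† (φ c j))

  outside-varGadget : ∀ {u i} → (u == xT i) ≡ false → (u == xF i) ≡ false → (u == x† i) ≡ false →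
                      (u == x̄† i) ≡ false → cutOf partition u (varEdges i) ≡ fin 0
  outside-varGadget ≠xT ≠xF ≠x† ≠x̄† =
    uncut refl ∷⁰ uncut refl ∷⁰ away ≠xT ≠x† ∷⁰ away ≠xT ≠x̄† ∷⁰ away ≠xF ≠x† ∷⁰ away ≠xF ≠x̄† ∷⁰ cutOf-[]

  outside-clauseGadget : ∀ {u c} → (∀ j → (u == p c j) ≡ false) → (u == Ca c) ≡ false → (u == Cb c) ≡ false →
                         cutOf partition u (clauseEdges φ c) ≡ fin 0
  outside-clauseGadget {c = c} ≠p ≠Ca ≠Cb =
    away (≠p j₂) ≠Cb ∷⁰ away (≠p j₃) ≠Cb ∷⁰ away (≠p j₁) ≠Ca ∷⁰ away ≠Cb ≠Ca ∷⁰
    literal-edges-silent c (uncut refl ∷⁰ cutOf-[])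

  varGadget-silent : ∀ {u i} → gadget u ≢ varGadget i → cutOf partition u (varEdges i) ≡ fin 0
  varGadget-silent {True}  _     = outside-varGadget refl refl refl refl
  varGadget-silent {False} _     = outside-varGadget refl refl refl refl
  varGadget-silent {xT k}  other = outside-varGadget (varGadget-apart other) refl refl refl
  varGadget-silent {xF k}  other = outside-varGadget refl (varGadget-apart other) refl refl
  varGadget-silent {x† k}  other = outside-varGadget refl refl (varGadget-apart other) refl
  varGadget-silent {x̄† k}  other = outside-varGadget refl refl refl (varGadget-apart other)
  varGadget-silent {p c j} _     = outside-varGadget refl refl refl refl
  varGadget-silent {Ca c}  _     = outside-varGadget refl refl refl refl
  varGadget-silent {Cb c}  _     = outside-varGadget refl refl refl refl

  clauseGadget-silent : ∀ {u c} → gadget u ≢ clauseGadget c → cutOf partition u (clauseEdges φ c) ≡ fin 0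
  clauseGadget-silent {True}  _     = outside-clauseGadget (λ _ → refl) refl refl
  clauseGadget-silent {False} _     = outside-clauseGadget (λ _ → refl) refl refl
  clauseGadget-silent {xT k}  _     = outside-clauseGadget (λ _ → refl) refl refl
  clauseGadget-silent {xF k}  _     = outside-clauseGadget (λ _ → refl) refl refl
  clauseGadget-silent {x† k}  _     = outside-clauseGadget (λ _ → refl) refl refl
  clauseGadget-silent {x̄† k}  _     = outside-clauseGadget (λ _ → refl) refl refl
  clauseGadget-silent {p d j} other =
    outside-clauseGadget (λ _ → p==p-apartˡ {n} (other ∘ cong (clauseGadget {n}))) refl refl
  clauseGadget-silent {Ca d}  other = outside-clauseGadget (λ _ → refl) (clauseGadget-apart other) refl
  clauseGadget-silent {Cb d}  other = outside-clauseGadget (λ _ → refl) refl (clauseGadget-apart other)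

  varGadget-cut≤1 : ∀ {u i} → gadget u ≡ varGadget i → cutOf partition u (varEdges i) ≤ʷ fin 1
  varGadget-cut≤1 {xT i} refl = ≤ʷ-trans (≤ʷ-reflexive
    (uncut refl ∷⁰ uncut refl ∷⁰ source ∷¹ source ∷¹ away refl refl ∷⁰ away refl refl ∷⁰ cutOf-[]))
    (mismatch-complementʳ true (σ i))
  varGadget-cut≤1 {xF i} refl = ≤ʷ-trans (≤ʷ-reflexive
    (uncut refl ∷⁰ uncut refl ∷⁰ away refl refl ∷⁰ away refl refl ∷⁰ source ∷¹ source ∷¹ cutOf-[]))
    (mismatch-complementʳ false (σ i))
  varGadget-cut≤1 {x† i} refl = ≤ʷ-trans (≤ʷ-reflexive
    (uncut refl ∷⁰ uncut refl ∷⁰ target ∷¹ away refl refl ∷⁰ target ∷¹ away refl refl ∷⁰ cutOf-[]))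
    (mismatch-complementˡ true (σ i))
  varGadget-cut≤1 {x̄† i} refl = ≤ʷ-trans (≤ʷ-reflexive
    (uncut refl ∷⁰ uncut refl ∷⁰ away refl refl ∷⁰ target ∷¹ away refl refl ∷⁰ target ∷¹ cutOf-[]))
    (mismatch-complementˡ true (not (σ i)))

  clauseGadget-cut≤1 : Satisfies σ φ → ∀ {u c} → gadget u ≡ clauseGadget c →
                       cutOf partition u (clauseEdges φ c) ≤ʷ fin 1
  clauseGadget-cut≤1 _ {p c Fin.zero} refl = ≤ʷ-trans (≤ʷ-reflexive
    (away (p==p-apartʳ {n} c j₁ j₂ λ ()) refl ∷⁰ away (p==p-apartʳ {n} c j₁ j₃ λ ()) refl ∷⁰ source ∷¹
     away refl refl ∷⁰ literal-edges-silent c (uncut refl ∷⁰ cutOf-[])))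
    (mismatch≤1 (value c j₁) true)
  clauseGadget-cut≤1 _ {p c (Fin.suc Fin.zero)} refl = ≤ʷ-trans (≤ʷ-reflexive
    (source ∷¹ away (p==p-apartʳ {n} c j₂ j₃ λ ()) refl ∷⁰ away (p==p-apartʳ {n} c j₂ j₁ λ ()) refl ∷⁰
     away refl refl ∷⁰ literal-edges-silent c (uncut refl ∷⁰ cutOf-[])))
    (mismatch≤1 (value c j₂) (value c j₂ ∨ value c j₃))
  clauseGadget-cut≤1 _ {p c (Fin.suc (Fin.suc Fin.zero))} refl = ≤ʷ-trans (≤ʷ-reflexive
    (away (p==p-apartʳ {n} c j₃ j₂ λ ()) refl ∷⁰ source ∷¹ away (p==p-apartʳ {n} c j₃ j₁ λ ()) refl ∷⁰
     away refl refl ∷⁰ literal-edges-silent c (uncut refl ∷⁰ cutOf-[])))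
    (mismatch≤1 (value c j₃) (value c j₂ ∨ value c j₃))
  clauseGadget-cut≤1 sat {Ca c} refl = ≤ʷ-trans (≤ʷ-reflexive
    (away refl refl ∷⁰ away refl refl ∷⁰ target ∷¹ target ∷¹ literal-edges-silent c (uncut refl ∷⁰ cutOf-[])))
    (mismatch-or-output (value c j₁) (value c j₂ ∨ value c j₃) (some-true⇒∨₃ (value c) _ (proj₂ (sat c))))
  clauseGadget-cut≤1 _ {Cb c} refl = ≤ʷ-trans (≤ʷ-reflexive
    (target ∷¹ target ∷¹ away refl refl ∷⁰ source ∷¹ literal-edges-silent c (uncut refl ∷⁰ cutOf-[])))
    (mismatch-or-gate (value c j₂) (value c j₃))

  cut≤1 : Satisfies σ φ → ∀ u → cut φ partition u ≤ʷ fin 1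
  cut≤1 sat u with gadget u in home
  ... | noGadget = cut≤-by-gadgets φ partition u
    (sum-zero _ λ i → varGadget-silent {i = i} (gadget-elsewhere home λ ()))
    (sum-zero _ λ c → clauseGadget-silent {c = c} (gadget-elsewhere home λ ()))
    (fin0≤ʷ (fin 1))
  ... | varGadget i = cut≤-by-gadgets φ partition u
    (sum-concentrated _ i λ j j≢i → varGadget-silent {i = j} (gadget-elsewhere home λ { refl → j≢i refl }))
    (sum-zero _ λ c → clauseGadget-silent {c = c} (gadget-elsewhere home λ ()))
    (subst (_≤ʷ fin 1) (sym (+ʷ-identityʳ _)) (varGadget-cut≤1 home))
  ... | clauseGadget c = cut≤-by-gadgets φ partition u
    (sum-zero _ λ i → varGadget-silent {i = i} (gadget-elsewhere home λ ()))
    (sum-concentrated _ c λ d d≢c → clauseGadget-silent {c = d} (gadget-elsewhere home λ { refl → d≢c refl }))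
    (subst (_≤ʷ fin 1) (sym (+ʷ-identityˡ _)) (clauseGadget-cut≤1 sat home))

lemma7p2 : (n m : ℕ) → n ≥ 1 → (φ : Formula n m) →
    Satisfiable φ ⇔ MinMaxCutIs φ (fin 1)
lemma7p2 n m n≥1 φ = mk⇔ satisfiable⇒minMaxCut minMaxCut⇒satisfiable
  where
  some-variable : Fin n
  some-variable = Fin.fromℕ< n≥1

  satisfiable⇒minMaxCut : Satisfiable φ → MinMaxCutIs φ (fin 1)
  satisfiable⇒minMaxCut (σ , sat) =
    (partition , refl , ≤ʷ-antisym (maxCut-lub φ partition (cut≤1 sat)) (maxCut-≥1 φ partition refl some-variable)) ,
    λ P sep → maxCut-≥1 φ P sep some-variable
    where open Forward φ σ

  minMaxCut⇒satisfiable : MinMaxCutIs φ (fin 1) → Satisfiable φ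
  minMaxCut⇒satisfiable ((P , sep , maxCut≡1) , _) = assignment , satisfies
    where open Backward φ P sep (λ u → subst (cut φ P u ≤ʷ_) maxCut≡1 (cut≤maxCut φ P u))
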